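{- Let $\Phi=C_n$ or $D_n$. Suppose ${\bf z}\in\mathbb{R}^n$ is the score sequence of some Coxeter tournament on the complete $\Phi$-graph, and ${\bf s}\in\mathbb{Z}^n$ satisfies $0\le s_i\le z_i$ and $s_i\equiv z_i\pmod 2$ for all $i\in[n]$. Then ${\bf s}$ is the score sequence of some Coxeter tournament on the complete $\Phi$-graph.
   Context: Let ${\bf e}_1,\dots,{\bf e}_n$ be the standard basis of $\mathbb{R}^n$, $C_n^+=\{{\bf e}_i\pm{\bf e}_j: i>j\in[n]\}\cup\{2{\bf e}_i:i\in[n]\}$, $D_n^+=\{{\bf e}_i\pm{\bf e}_j: i>j\in[n]\}$. A Coxeter tournament on the complete $\Phi$-graph is an assignment of $w_{\bf e}\in\{0,1\}$ to each ${\bf e}\in\Phi^+$; its score sequence is $\sum_{{\bf e}\in\Phi^+}(w_{\bf e}-1/2){\bf e}$ (such score sequences lie in $\mathbb{Z}^n$). -}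

module Defs where

open import Data.Nat using (ℕ)
open import Data.Fin using (Fin; _<_; _<?_)
open import Data.Fin.Base using ()
open import Data.List using (List; []; _∷_; _++_; concatMap; map; foldr; allFin)
open import Data.Bool using (Bool; true; false)
open import Data.Integer using (ℤ; +_; -_; _+_; _*_; _-_; 0ℤ; 1ℤ)
open import Data.Product using (∃; Σ)
open import Relation.Nullary using (yes; no)
open import Relation.Binary.PropositionalEquality using (_≡_)

data RootSystem : Set where
  C D : RootSystem

data Sign : Set where
  plus minus : Sign

-- Positive roots of C_n / D_n:
--   short i j p s  represents  e_i + e_j (s = plus) or e_i - e_j (s = minus), with j < i;
--   long i         represents  2 e_i  (only in type C).
data PosRoot : RootSystem → ℕ → Set where
  short : ∀ {Φ n} (i j : Fin n) → j < i → Sign → PosRoot Φ n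
  long  : ∀ {n} → Fin n → PosRoot C n

Vecℤ : ℕ → Set
Vecℤ n = Fin n → ℤ

δ : ∀ {n} → Fin n → Fin n → ℤ
δ i k with i Data.Fin.≟ k
... | yes _ = 1ℤ
... | no  _ = 0ℤ

signℤ : Sign → ℤ
signℤ plus  = 1ℤ
signℤ minus = - 1ℤ

rootVec : ∀ {Φ n} → PosRoot Φ n → Vecℤ n
rootVec (short i j _ s) k = δ i k + signℤ s * δ j k
rootVec (long i)        k = + 2 * δ i k

shortRoots : ∀ Φ n → List (PosRoot Φ n)
shortRoots Φ n = concatMap (λ i → concatMap (λ j → pick i j) (allFin n)) (allFin n)
  where
  pick : Fin n → Fin n → List (PosRoot Φ n)
  pick i j with j <? i
  ... | yes p = short i j p plus ∷ short i j p minus ∷ []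
  ... | no  _ = []

posRoots : ∀ Φ n → List (PosRoot Φ n)
posRoots C n = shortRoots C n ++ map long (allFin n)
posRoots D n = shortRoots D n

-- A Coxeter tournament on the complete Φ-graph: a weight w_e ∈ {0,1} for each e ∈ Φ^+.
Tournament : RootSystem → ℕ → Set
Tournament Φ n = PosRoot Φ n → Bool

twoWMinusOne : Bool → ℤ
twoWMinusOne true  = 1ℤ
twoWMinusOne false = - 1ℤ

-- Twice the score sequence:  2 · Σ_{e ∈ Φ^+} (w_e - 1/2) e  =  Σ_{e ∈ Φ^+} (2 w_e - 1) e.
doubledScore : ∀ {Φ n} → Tournament Φ n → Vecℤ n
doubledScore {Φ} {n} w k =
  foldr (λ e acc → twoWMinusOne (w e) * rootVec e k + acc) 0ℤ (posRoots Φ n)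

HasScore : ∀ {Φ n} → Tournament Φ n → Vecℤ n → Set
HasScore w s = ∀ k → doubledScore w k ≡ + 2 * s k

IsScoreSequence : ∀ Φ n → Vecℤ n → Set
IsScoreSequence Φ n s = ∃ λ (w : Tournament Φ n) → HasScore w s

-- Group Φ⁺ into the blocks {e_i + e_j, e_i − e_j}
-- (j < i) and, in type C, {2e_i}: whatever the weights, a block contributes ±2e_m for some m.  If
-- z_k > 0, the k-th coordinate of 2z is positive, so some block contributes +2e_k; reversing every
-- arc of that block turns this into −2e_k, so z − 2e_k is again a score sequence.  Writing
-- z = s + 2 Σ_{k ∈ ks} e_k for a list ks of coordinates and peeling off one e_k at a time, the
-- coordinate being lowered is always at least s_k + 2 > 0, so s is reached.

module Submission where

open import Defs
open import Data.Nat using (ℕ)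
open import Data.Fin using (Fin)
open import Data.Integer using (ℤ; +_; _-_; _≤_)
open import Data.Integer.Divisibility using (_∣_)
open import Data.Product using (_×_)

open import Data.Bool using (Bool; true; false; not; _∧_; _xor_)
open import Data.Bool.Properties using (∧-zeroʳ)
open import Data.Empty using (⊥-elim)
open import Data.Fin using (zero; suc; _<_; _<?_; _≟_; punchIn)
open import Data.Fin.Properties using (punchInᵢ≢i)
open import Data.Integer as ℤ using (_+_; _*_; -_; ∣_∣; 0ℤ; 1ℤ; +≤+; +<+)
import Data.Integer.Properties as ℤP
open import Data.Integer.Tactic.RingSolver using (solve-∀)
open import Data.List using (List; []; _∷_; _++_; concatMap; map; foldr; allFin; tabulate; replicate)
open import Data.List.Properties using (concatMap-cong; foldr-cong; foldr-map)
open import Data.List.Relation.Unary.All using (All; []; _∷_)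
open import Data.Nat as ℕ using (s≤s; z≤n)
open import Data.Nat.Divisibility using (divides)
open import Data.Product using (Σ; ∃; ∃₂; _,_; proj₁; proj₂)
open import Data.Sum using (_⊎_; inj₁; inj₂)
open import Function using (_∘_)
open import Relation.Binary.PropositionalEquality
open import Relation.Nullary using (Dec; yes; no; does)
open import Relation.Nullary.Decidable using (dec-true; dec-false)

open import Algebra.Properties.CommutativeMonoid.Sum ℤP.+-0-commutativeMonoid
  using (sum; sum-remove; sum-cong-≗; sum-replicate-zero)

private
  variable
    Φ : RootSystem
    n : ℕ
    A B : Set

sumList : (A → ℤ) → List A → ℤ
sumList f = foldr (λ x acc → f x + acc) 0ℤ

sumList-++ : (f : A → ℤ) (xs ys : List A) → sumList f (xs ++ ys) ≡ sumList f xs + sumList f ys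
sumList-++ f []       ys = sym (ℤP.+-identityˡ _)
sumList-++ f (x ∷ xs) ys =
  trans (cong (_+_ (f x)) (sumList-++ f xs ys)) (sym (ℤP.+-assoc (f x) _ _))

sumList-concatMap : (f : B → ℤ) (g : A → List B) (xs : List A) →
  sumList f (concatMap g xs) ≡ sumList (sumList f ∘ g) xs
sumList-concatMap f g []       = refl
sumList-concatMap f g (x ∷ xs) =
  trans (sumList-++ f (g x) _) (cong (_+_ (sumList f (g x))) (sumList-concatMap f g xs))

sumList-map : (f : B → ℤ) (g : A → B) (xs : List A) → sumList f (map g xs) ≡ sumList (f ∘ g) xs
sumList-map f g = foldr-map _ g 0ℤ

sumList-cong : {f g : A → ℤ} → (∀ x → f x ≡ g x) → (xs : List A) → sumList f xs ≡ sumList g xs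
sumList-cong f≗g = foldr-cong (λ x acc → cong (_+ acc) (f≗g x)) refl

sumList-replicate : (f : A → ℤ) (m : ℕ) (x : A) → sumList f (replicate m x) ≡ + m * f x
sumList-replicate f ℕ.zero    x = sym (ℤP.*-zeroˡ (f x))
sumList-replicate f (ℕ.suc m) x =
  trans (cong (_+_ (f x)) (sumList-replicate f m x)) (sym (ℤP.suc-* (+ m) (f x)))

sumList-nonNegative : {f : A → ℤ} → (∀ x → + 0 ≤ f x) → (xs : List A) → + 0 ≤ sumList f xs
sumList-nonNegative f≥0 []       = ℤP.≤-refl
sumList-nonNegative f≥0 (x ∷ xs) = ℤP.+-mono-≤ (f≥0 x) (sumList-nonNegative f≥0 xs)

sumList-tabulate : (f : A → ℤ) (g : Fin n → A) → sumList f (tabulate g) ≡ sum (f ∘ g)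
sumList-tabulate {n = ℕ.zero}  f g = refl
sumList-tabulate {n = ℕ.suc n} f g = cong (_+_ (f (g zero))) (sumList-tabulate f (g ∘ suc))

sumList-allFin : (f : Fin n → ℤ) → sumList f (allFin n) ≡ sum f
sumList-allFin f = sumList-tabulate f (λ i → i)

sum-changeAt : (f g : Fin n → ℤ) (a : Fin n) {d : ℤ} →
  (∀ i → i ≢ a → g i ≡ f i) → g a ≡ f a + d → sum g ≡ sum f + d
sum-changeAt {n = ℕ.suc n} f g a {d} off on = begin
  sum g                             ≡⟨ sum-remove {i = a} g ⟩
  g a + sum (g ∘ punchIn a)         ≡⟨ cong₂ _+_ on (sum-cong-≗ (λ i → off _ (punchInᵢ≢i a i))) ⟩
  f a + d + sum (f ∘ punchIn a)     ≡⟨ swap (f a) d _ ⟩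
  f a + sum (f ∘ punchIn a) + d     ≡⟨ cong (_+ d) (sym (sum-remove {i = a} f)) ⟩
  sum f + d                         ∎
  where
  open ≡-Reasoning
  swap : ∀ x y z → x + y + z ≡ x + z + y
  swap = solve-∀

+-positive : ∀ a b → 0ℤ ℤ.< a + b → 0ℤ ℤ.< a ⊎ 0ℤ ℤ.< b
+-positive a b 0<a+b with 0ℤ ℤ.<? a | 0ℤ ℤ.<? b
... | yes 0<a | _       = inj₁ 0<a
... | no  _   | yes 0<b = inj₂ 0<b
... | no  a≯0 | no  b≯0 =
  ⊥-elim (ℤP.<-irrefl refl (ℤP.<-≤-trans 0<a+b (ℤP.+-mono-≤ (ℤP.≮⇒≥ a≯0) (ℤP.≮⇒≥ b≯0))))

positive-summand : (f : Fin n → ℤ) → 0ℤ ℤ.< sum f → ∃ λ i → 0ℤ ℤ.< f i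
positive-summand {n = ℕ.zero}  f (+<+ ())
positive-summand {n = ℕ.suc n} f 0<sum with +-positive (f zero) _ 0<sum
... | inj₁ 0<f₀   = zero , 0<f₀
... | inj₂ 0<rest = let i , 0<fᵢ = positive-summand (f ∘ suc) 0<rest in suc i , 0<fᵢ

sum-concentrated : (f : Fin n → ℤ) (i : Fin n) → (∀ k → k ≢ i → f k ≡ 0ℤ) → sum f ≡ f i
sum-concentrated {n} f i off = begin
  sum f                  ≡⟨ sum-changeAt (λ _ → 0ℤ) f i {f i} off (sym (ℤP.+-identityˡ (f i))) ⟩
  sum {n} (λ _ → 0ℤ) + f i ≡⟨ cong (_+ f i) (sum-replicate-zero n) ⟩
  0ℤ + f i               ≡⟨ ℤP.+-identityˡ (f i) ⟩
  f i                    ∎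
  where open ≡-Reasoning

δ-diag : (k : Fin n) → δ k k ≡ 1ℤ
δ-diag k with k ≟ k
... | yes _   = refl
... | no  k≢k = ⊥-elim (k≢k refl)

δ-offDiag : {i k : Fin n} → i ≢ k → δ i k ≡ 0ℤ
δ-offDiag {i = i} {k} i≢k with i ≟ k
... | yes i≡k = ⊥-elim (i≢k i≡k)
... | no  _   = refl

twice-δ-nonNegative : (i k : Fin n) → + 0 ≤ + 2 * δ i k
twice-δ-nonNegative i k with i ≟ k
... | yes _ = +≤+ z≤n
... | no  _ = +≤+ z≤n

TwiceUnit : Vecℤ n → Set
TwiceUnit {n} v = ∃₂ λ (b : Bool) (m : Fin n) → ∀ k → v k ≡ twoWMinusOne b * (+ 2 * δ m k)

signedTwice-δ-positive : ∀ b (m k : Fin n) → 0ℤ ℤ.< twoWMinusOne b * (+ 2 * δ m k) →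
  b ≡ true × m ≡ k
signedTwice-δ-positive b m k 0<v with m ≟ k
signedTwice-δ-positive true  m k _          | yes m≡k = refl , m≡k
signedTwice-δ-positive false m k ()         | yes _
signedTwice-δ-positive true  m k (+<+ ())   | no  _
signedTwice-δ-positive false m k (+<+ ())   | no  _

twiceUnit-positive : {v : Vecℤ n} {k : Fin n} → TwiceUnit v → 0ℤ ℤ.< v k →
  ∀ k' → v k' ≡ + 2 * δ k k'
twiceUnit-positive {k = k} (b , m , v≡) 0<vk k'
  with refl , refl ← signedTwice-δ-positive b m k (subst (0ℤ ℤ.<_) (v≡ k) 0<vk) =
  trans (v≡ k') (ℤP.*-identityˡ _)

-- doubledScore w k is definitionally sumList (contribution w k) (posRoots Φ n).
contribution : Tournament Φ n → Fin n → PosRoot Φ n → ℤ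
contribution w k e = twoWMinusOne (w e) * rootVec e k

pairBlock : (i j : Fin n) → Dec (j < i) → List (PosRoot Φ n)
pairBlock i j (yes j<i) = short i j j<i plus ∷ short i j j<i minus ∷ []
pairBlock i j (no  _)   = []

-- shortRoots enumerates each block through a local function of its where clause, which cannot be
-- named; unifying against the unfolded definition recovers it.
shortRootsBlock : ∀ Φ n → Fin n → Fin n → List (PosRoot Φ n)
shortRootsBlock Φ n = proj₁ unfolded
  where
  unfolded : Σ (Fin n → Fin n → List (PosRoot Φ n)) λ pick →
    shortRoots Φ n ≡ concatMap (λ i → concatMap (pick i) (allFin n)) (allFin n)
  unfolded = _ , refl

shortRootsBlock-pairBlock : (i j : Fin n) → shortRootsBlock Φ n i j ≡ pairBlock i j (j <? i)
shortRootsBlock-pairBlock i j with j <? i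
... | yes _ = refl
... | no  _ = refl

sumList-shortRoots : (f : PosRoot Φ n → ℤ) →
  sumList f (shortRoots Φ n) ≡ sum λ i → sum λ j → sumList f (pairBlock i j (j <? i))
sumList-shortRoots {Φ} {n} f = begin
  sumList f (concatMap (λ i → concatMap (shortRootsBlock Φ n i) all) all)
    ≡⟨ cong (sumList f) (concatMap-cong (λ i → concatMap-cong (shortRootsBlock-pairBlock i) all) all) ⟩
  sumList f (concatMap (λ i → concatMap (λ j → pairBlock i j (j <? i)) all) all)
    ≡⟨ sumList-concatMap f _ all ⟩
  sumList (λ i → sumList f (concatMap (λ j → pairBlock i j (j <? i)) all)) all
    ≡⟨ sumList-cong (λ i → trans (sumList-concatMap f _ all) (sumList-allFin (block i))) all ⟩
  sumList (λ i → sum (block i)) all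
    ≡⟨ sumList-allFin (λ i → sum (block i)) ⟩
  (sum λ i → sum (block i))
    ∎
  where
  open ≡-Reasoning
  all = allFin n
  block : Fin n → Fin n → ℤ
  block i j = sumList f (pairBlock i j (j <? i))

pairScore : Tournament Φ n → Fin n → Fin n → Vecℤ n
pairScore w i j k = sumList (contribution w k) (pairBlock i j (j <? i))

longScore : Tournament C n → Fin n → Vecℤ n
longScore w i k = contribution w k (long i)

pairPart : Tournament Φ n → Vecℤ n
pairPart w k = sum λ i → sum λ j → pairScore w i j k

longPart : ∀ Φ → Tournament Φ n → Vecℤ n
longPart C w k = sum λ i → longScore w i k
longPart D w k = 0ℤ

doubledScore-parts : (w : Tournament Φ n) (k : Fin n) → doubledScore w k ≡ pairPart w k + longPart Φ w k
doubledScore-parts {C} {n} w k = begin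
  sumList c (shortRoots C n ++ map long (allFin n))
    ≡⟨ sumList-++ c (shortRoots C n) _ ⟩
  sumList c (shortRoots C n) + sumList c (map long (allFin n))
    ≡⟨ cong₂ _+_ (sumList-shortRoots c)
                 (trans (sumList-map c long (allFin n)) (sumList-allFin (c ∘ long))) ⟩
  pairPart w k + longPart C w k
    ∎
  where
  open ≡-Reasoning
  c = contribution w k
doubledScore-parts {D} {n} w k = trans (sumList-shortRoots (contribution w k)) (sym (ℤP.+-identityʳ _))

pairBlock-twiceUnit : (w : Tournament Φ n) (i j : Fin n) (j<i : j < i) →
  TwiceUnit (λ k → sumList (contribution w k) (pairBlock i j (yes j<i)))
pairBlock-twiceUnit w i j j<i with w (short i j j<i plus) | w (short i j j<i minus)
... | true  | true  = true  , i , λ k → both-won    (δ i k) (δ j k)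
  where
  both-won : ∀ x y → 1ℤ * (x + 1ℤ * y) + (1ℤ * (x + - 1ℤ * y) + 0ℤ) ≡ 1ℤ * (+ 2 * x)
  both-won = solve-∀
... | true  | false = true  , j , λ k → plus-won    (δ i k) (δ j k)
  where
  plus-won : ∀ x y → 1ℤ * (x + 1ℤ * y) + (- 1ℤ * (x + - 1ℤ * y) + 0ℤ) ≡ 1ℤ * (+ 2 * y)
  plus-won = solve-∀
... | false | true  = false , j , λ k → minus-won   (δ i k) (δ j k)
  where
  minus-won : ∀ x y → - 1ℤ * (x + 1ℤ * y) + (1ℤ * (x + - 1ℤ * y) + 0ℤ) ≡ - 1ℤ * (+ 2 * y)
  minus-won = solve-∀
... | false | false = false , i , λ k → both-lost   (δ i k) (δ j k)
  where
  both-lost : ∀ x y → - 1ℤ * (x + 1ℤ * y) + (- 1ℤ * (x + - 1ℤ * y) + 0ℤ) ≡ - 1ℤ * (+ 2 * x)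
  both-lost = solve-∀

pairScore-positive : (w : Tournament Φ n) (i j : Fin n) {k : Fin n} → 0ℤ ℤ.< pairScore w i j k →
  ∀ k' → pairScore w i j k' ≡ + 2 * δ k k'
pairScore-positive w i j 0<score with j <? i
... | yes j<i = twiceUnit-positive (pairBlock-twiceUnit w i j j<i) 0<score
... | no  _   = ⊥-elim (ℤP.<-irrefl refl 0<score)

longScore-positive : (w : Tournament C n) (i : Fin n) {k : Fin n} → 0ℤ ℤ.< longScore w i k →
  ∀ k' → longScore w i k' ≡ + 2 * δ k k'
longScore-positive w i = twiceUnit-positive (w (long i) , i , λ _ → refl)

twoWMinusOne-not : ∀ b → twoWMinusOne (not b) ≡ - twoWMinusOne b
twoWMinusOne-not true  = refl
twoWMinusOne-not false = refl

reverseOn : (PosRoot Φ n → Bool) → Tournament Φ n → Tournament Φ n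
reverseOn P w e = P e xor w e

module _ (P : PosRoot Φ n → Bool) (w : Tournament Φ n) (k : Fin n) where

  contribution-reverseOn-outside : ∀ {e} → P e ≡ false →
    contribution (reverseOn P w) k e ≡ contribution w k e
  contribution-reverseOn-outside {e} Pe rewrite Pe = refl

  contribution-reverseOn-inside : ∀ {e} → P e ≡ true →
    contribution (reverseOn P w) k e ≡ - contribution w k e
  contribution-reverseOn-inside {e} Pe rewrite Pe =
    trans (cong (_* rootVec e k) (twoWMinusOne-not (w e)))
          (sym (ℤP.neg-distribˡ-* (twoWMinusOne (w e)) (rootVec e k)))

  sumList-reverseOn-outside : ∀ {es} → All (λ e → P e ≡ false) es →
    sumList (contribution (reverseOn P w) k) es ≡ sumList (contribution w k) es
  sumList-reverseOn-outside []         = refl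
  sumList-reverseOn-outside (Pe ∷ Pes) =
    cong₂ _+_ (contribution-reverseOn-outside Pe) (sumList-reverseOn-outside Pes)

  sumList-reverseOn-inside : ∀ {es} → All (λ e → P e ≡ true) es →
    sumList (contribution (reverseOn P w) k) es ≡ - sumList (contribution w k) es
  sumList-reverseOn-inside []         = refl
  sumList-reverseOn-inside {e ∷ es} (Pe ∷ Pes) =
    trans (cong₂ _+_ (contribution-reverseOn-inside Pe) (sumList-reverseOn-inside Pes))
          (sym (ℤP.neg-distrib-+ (contribution w k e) (sumList (contribution w k) es)))

pairBlock-all : ∀ {Q : PosRoot Φ n → Set} {i j} → (∀ j<i s → Q (short i j j<i s)) →
  (d : Dec (j < i)) → All Q (pairBlock i j d)
pairBlock-all Q-short (yes j<i) = Q-short j<i plus ∷ Q-short j<i minus ∷ []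
pairBlock-all Q-short (no  _)   = []

inPair : Fin n → Fin n → PosRoot Φ n → Bool
inPair i₀ j₀ (short i j _ _) = does (i ≟ i₀) ∧ does (j ≟ j₀)
inPair i₀ j₀ (long _)        = false

inPair-outside : ∀ (i₀ j₀ i j : Fin n) j<i s → i ≢ i₀ ⊎ j ≢ j₀ →
  inPair {Φ = Φ} i₀ j₀ (short i j j<i s) ≡ false
inPair-outside i₀ j₀ i j _ _ (inj₁ i≢i₀) rewrite dec-false (i ≟ i₀) i≢i₀ = refl
inPair-outside i₀ j₀ i j _ _ (inj₂ j≢j₀) rewrite dec-false (j ≟ j₀) j≢j₀ = ∧-zeroʳ _

inPair-inside : ∀ (i₀ j₀ : Fin n) j<i s → inPair {Φ = Φ} i₀ j₀ (short i₀ j₀ j<i s) ≡ true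
inPair-inside i₀ j₀ _ _ rewrite dec-true (i₀ ≟ i₀) refl | dec-true (j₀ ≟ j₀) refl = refl

isLongAt : Fin n → PosRoot C n → Bool
isLongAt i₀ (short _ _ _ _) = false
isLongAt i₀ (long i)        = does (i ≟ i₀)

x≡2t⇒-x≡x-4t : ∀ {x} t → x ≡ + 2 * t → - x ≡ x - + 4 * t
x≡2t⇒-x≡x-4t t refl = lemma t
  where
  lemma : ∀ t → - (+ 2 * t) ≡ + 2 * t - + 4 * t
  lemma = solve-∀

reversePair-lowers : (w : Tournament Φ n) {i₀ j₀ k : Fin n} → 0ℤ ℤ.< pairScore w i₀ j₀ k →
  ∀ k' → doubledScore (reverseOn (inPair i₀ j₀) w) k' ≡ doubledScore w k' - + 4 * δ k k'
reversePair-lowers {Φ} {n} w {i₀} {j₀} {k} 0<score k' = begin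
  doubledScore w' k'                                  ≡⟨ doubledScore-parts w' k' ⟩
  pairPart w' k' + longPart Φ w' k'                   ≡⟨ cong₂ _+_ pairPart-lowered (longPart-unchanged Φ w) ⟩
  pairPart w k' + - (+ 4 * δ k k') + longPart Φ w k'  ≡⟨ swap (pairPart w k') _ _ ⟩
  pairPart w k' + longPart Φ w k' - + 4 * δ k k'      ≡⟨ cong (_- _) (sym (doubledScore-parts w k')) ⟩
  doubledScore w k' - + 4 * δ k k'                    ∎
  where
  open ≡-Reasoning
  P = inPair i₀ j₀
  w' = reverseOn P w

  outside : ∀ i j → i ≢ i₀ ⊎ j ≢ j₀ → pairScore w' i j k' ≡ pairScore w i j k'
  outside i j i≢i₀⊎j≢j₀ =
    sumList-reverseOn-outside P w k'
      (pairBlock-all (λ j<i s → inPair-outside {Φ = Φ} i₀ j₀ i j j<i s i≢i₀⊎j≢j₀) (j <? i))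

  inside : pairScore w' i₀ j₀ k' ≡ - pairScore w i₀ j₀ k'
  inside = sumList-reverseOn-inside P w k' (pairBlock-all (inPair-inside {Φ = Φ} i₀ j₀) (j₀ <? i₀))

  pairPart-lowered : pairPart w' k' ≡ pairPart w k' + - (+ 4 * δ k k')
  pairPart-lowered =
    sum-changeAt _ _ i₀ (λ i i≢i₀ → sum-cong-≗ (λ j → outside i j (inj₁ i≢i₀)))
      (sum-changeAt _ _ j₀ (λ j j≢j₀ → outside i₀ j (inj₂ j≢j₀))
        (trans inside (x≡2t⇒-x≡x-4t (δ k k') (pairScore-positive w i₀ j₀ 0<score k'))))

  longPart-unchanged : ∀ Ψ (v : Tournament Ψ n) →
    longPart Ψ (reverseOn (inPair i₀ j₀) v) k' ≡ longPart Ψ v k'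
  longPart-unchanged C v =
    sum-cong-≗ (λ i → contribution-reverseOn-outside (inPair i₀ j₀) v k' {long i} refl)
  longPart-unchanged D v = refl

  swap : ∀ x y z → x + y + z ≡ x + z + y
  swap = solve-∀

reverseLong-lowers : (w : Tournament C n) {i₀ k : Fin n} → 0ℤ ℤ.< longScore w i₀ k →
  ∀ k' → doubledScore (reverseOn (isLongAt i₀) w) k' ≡ doubledScore w k' - + 4 * δ k k'
reverseLong-lowers w {i₀} {k} 0<score k' = begin
  doubledScore w' k'                                  ≡⟨ doubledScore-parts w' k' ⟩
  pairPart w' k' + longPart C w' k'                   ≡⟨ cong₂ _+_ pairPart-unchanged longPart-lowered ⟩
  pairPart w k' + (longPart C w k' - + 4 * δ k k')    ≡⟨ sym (ℤP.+-assoc (pairPart w k') _ _) ⟩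
  pairPart w k' + longPart C w k' - + 4 * δ k k'      ≡⟨ cong (_- _) (sym (doubledScore-parts w k')) ⟩
  doubledScore w k' - + 4 * δ k k'                    ∎
  where
  open ≡-Reasoning
  P = isLongAt i₀
  w' = reverseOn P w

  pairPart-unchanged : pairPart w' k' ≡ pairPart w k'
  pairPart-unchanged = sum-cong-≗ λ i → sum-cong-≗ λ j →
    sumList-reverseOn-outside P w k' (pairBlock-all (λ _ _ → refl) (j <? i))

  longPart-lowered : longPart C w' k' ≡ longPart C w k' + - (+ 4 * δ k k')
  longPart-lowered = sum-changeAt _ _ i₀
    (λ i i≢i₀ → contribution-reverseOn-outside P w k' (dec-false (i ≟ i₀) i≢i₀))
    (trans (contribution-reverseOn-inside P w k' (dec-true (i₀ ≟ i₀) refl))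
           (x≡2t⇒-x≡x-4t (δ k k') (longScore-positive w i₀ 0<score k')))

IsScoreSequence-resp : {z z' : Vecℤ n} → (∀ i → z i ≡ z' i) →
  IsScoreSequence Φ n z → IsScoreSequence Φ n z'
IsScoreSequence-resp z≗z' (w , hw) = w , λ k → trans (hw k) (cong (+ 2 *_) (z≗z' k))

double-positive : ∀ {x} → 0ℤ ℤ.< x → 0ℤ ℤ.< + 2 * x
double-positive (+<+ (s≤s _)) = +<+ (s≤s z≤n)

HasScore-lowered : (w w' : Tournament Φ n) {z : Vecℤ n} {k : Fin n} → HasScore w z →
  (∀ k' → doubledScore w' k' ≡ doubledScore w k' - + 4 * δ k k') →
  HasScore w' (λ i → z i - + 2 * δ k i)
HasScore-lowered _ _ {z} {k} hw lowers k' =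
  trans (lowers k') (trans (cong (_- _) (hw k')) (halve (z k') (δ k k')))
  where
  halve : ∀ x t → + 2 * x - + 4 * t ≡ + 2 * (x - + 2 * t)
  halve = solve-∀

lower-step : {z : Vecℤ n} {k : Fin n} → IsScoreSequence Φ n z → 0ℤ ℤ.< z k →
  IsScoreSequence Φ n (λ i → z i - + 2 * δ k i)
lower-step {Φ = Φ} {k = k} (w , hw) 0<zk
  with +-positive (pairPart w k) (longPart Φ w k)
         (subst (0ℤ ℤ.<_) (trans (sym (hw k)) (doubledScore-parts w k)) (double-positive 0<zk))
... | inj₁ 0<pairs =
  let i₀ , 0<row   = positive-summand _ 0<pairs
      j₀ , 0<block = positive-summand _ 0<row
      w' = reverseOn (inPair i₀ j₀) w
  in w' , HasScore-lowered w w' hw (reversePair-lowers w 0<block)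
lower-step {Φ = C} (w , hw) _ | inj₂ 0<longs =
  let i₀ , 0<long = positive-summand _ 0<longs
      w' = reverseOn (isLongAt i₀) w
  in w' , HasScore-lowered w w' hw (reverseLong-lowers w 0<long)
lower-step {Φ = D} _ _ | inj₂ (+<+ ())

raise : Vecℤ n → List (Fin n) → Vecℤ n
raise s ks i = s i + sumList (λ k → + 2 * δ k i) ks

lower-raised : {s : Vecℤ n} → (∀ i → + 0 ≤ s i) → ∀ ks →
  IsScoreSequence Φ n (raise s ks) → IsScoreSequence Φ n s
lower-raised {s = s} s≥0 [] score = IsScoreSequence-resp (λ i → ℤP.+-identityʳ (s i)) score
lower-raised {s = s} s≥0 (k ∷ ks) score =
  lower-raised s≥0 ks (IsScoreSequence-resp peel (lower-step score 0<raised))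
  where
  rest : Vecℤ _
  rest i = sumList (λ k' → + 2 * δ k' i) ks

  0<raised : 0ℤ ℤ.< s k + (+ 2 * δ k k + rest k)
  0<raised rewrite δ-diag k =
    ℤP.+-mono-≤-< (s≥0 k)
      (ℤP.+-mono-<-≤ (+<+ (s≤s z≤n)) (sumList-nonNegative (λ k' → twice-δ-nonNegative k' k) ks))

  peel : ∀ i → raise s (k ∷ ks) i - + 2 * δ k i ≡ raise s ks i
  peel i = cancel (s i) (+ 2 * δ k i) (rest i)
    where
    cancel : ∀ a t b → a + (t + b) - t ≡ a + b
    cancel = solve-∀

raise-replicate : (s : Vecℤ n) (m : Fin n → ℕ) (i : Fin n) →
  raise s (concatMap (λ k → replicate (m k) k) (allFin n)) i ≡ s i + + m i * + 2
raise-replicate {n} s m i = cong (_+_ (s i)) (begin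
  sumList twiceδ (concatMap (λ k → replicate (m k) k) (allFin n))
    ≡⟨ sumList-concatMap twiceδ _ (allFin n) ⟩
  sumList (λ k → sumList twiceδ (replicate (m k) k)) (allFin n)
    ≡⟨ sumList-cong (λ k → sumList-replicate twiceδ (m k) k) (allFin n) ⟩
  sumList (λ k → + m k * twiceδ k) (allFin n)
    ≡⟨ sumList-allFin (λ k → + m k * twiceδ k) ⟩
  sum (λ k → + m k * twiceδ k)
    ≡⟨ sum-concentrated _ i (λ k k≢i →
         trans (cong (λ t → + m k * (+ 2 * t)) (δ-offDiag k≢i)) (ℤP.*-zeroʳ (+ m k))) ⟩
  + m i * twiceδ i
    ≡⟨ cong (λ t → + m i * (+ 2 * t)) (δ-diag i) ⟩
  + m i * + 2
    ∎)
  where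
  open ≡-Reasoning
  twiceδ : Fin n → ℤ
  twiceδ k = + 2 * δ k i

even-gap : {s z : ℤ} → s ≤ z → + 2 ∣ s - z → ∃ λ m → z ≡ s + + m * + 2
even-gap {s} {z} s≤z (divides m ∣s-z∣≡m*2) = m , (begin
  z                  ≡⟨ split s z ⟩
  s + (z - s)        ≡⟨ cong (_+_ s) (sym (ℤP.0≤i⇒+∣i∣≡i (ℤP.i≤j⇒0≤j-i s≤z))) ⟩
  s + + ∣ z - s ∣    ≡⟨ cong (λ t → s + + t) (trans (ℤP.∣i-j∣≡∣j-i∣ z s) ∣s-z∣≡m*2) ⟩
  s + + (m ℕ.* 2)    ≡⟨ cong (_+_ s) (ℤP.pos-* m 2) ⟩
  s + + m * + 2      ∎)
  where
  open ≡-Reasoning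
  split : ∀ s z → z ≡ s + (z - s)
  split = solve-∀

lemma4p4 : (Φ : RootSystem) (n : ℕ) (z s : Vecℤ n) →
    IsScoreSequence Φ n z →
    (∀ i → (+ 0 ≤ s i) × (s i ≤ z i)) →
    (∀ i → (+ 2) ∣ (s i - z i)) →
    IsScoreSequence Φ n s
lemma4p4 Φ n z s z-score bounds parity =
  lower-raised (proj₁ ∘ bounds) ks (IsScoreSequence-resp z≡raised z-score)
  where
  gap : ∀ i → ∃ λ m → z i ≡ s i + + m * + 2
  gap i = even-gap (proj₂ (bounds i)) (parity i)

  ks : List (Fin n)
  ks = concatMap (λ k → replicate (proj₁ (gap k)) k) (allFin n)

  z≡raised : ∀ i → z i ≡ raise s ks i
  z≡raised i = trans (proj₂ (gap i)) (sym (raise-replicate s (proj₁ ∘ gap) i))
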